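{- For every positive integer $n$, \[ B_{2n} = (-1)^{n-1} \Biggl[ a_n - b_n \sum_{k=0}^{\lfloor n/2 \rfloor}\frac{B_{2k}}{(2k)!\,(n-2k)!\,(n-k)} + (2n)! \sum_{k=0}^{\lfloor n/2 \rfloor}\frac{B_{2k}}{(2k)!\,(n-2k)!} \sum_{j=0}^{\lfloor n/2 \rfloor}\frac{B_{2j}}{(2j)!\,(n-2j)!}\cdot\frac{1}{2n-2k-2j+1} \Biggr], \] where $a_n = \frac{n}{2}\,\frac{(2n-2)!}{((n-1)!)^2}$ and $b_n = \frac{(2n)!}{2\,(n-1)!}$.
   Context: The Bernoulli numbers $B_m$ ($m \ge 0$ an integer) are defined by the generating function $\frac{x}{e^x-1} = \sum_{m=0}^\infty B_m \frac{x^m}{m!}$ for $|x|<2\pi$; in particular $B_0 = 1$, $B_1 = -\tfrac12$, $B_2 = \tfrac16$. -}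

module Defs where

open import Data.Nat as ℕ using (ℕ; zero; suc; _∸_; _!)
open import Data.Integer using (+_)
open import Data.Rational using (ℚ; _/_; 0ℚ; 1ℚ; _+_; _*_; -_; _-_)
open import Data.List using (List; []; _∷_; map; zipWith; upTo; foldr)

-- Reciprocal of a natural number as a rational; 1/n for n ≥ 1.
-- (Value at 0 is an arbitrary junk value 0; it is only ever applied
-- to positive arguments below.)
inv : ℕ → ℚ
inv zero    = 0ℚ
inv (suc n) = + 1 / suc n

ℕ→ℚ : ℕ → ℚ
ℕ→ℚ n = + n / 1

Σ< : ℕ → (ℕ → ℚ) → ℚ
Σ< n f = foldr _+_ 0ℚ (map f (upTo n))

neg1^ : ℕ → ℚ
neg1^ zero    = 1ℚ
neg1^ (suc n) = - neg1^ n

-- Coefficients c_m of the formal power series x/(e^x - 1) = Σ c_m x^m,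
-- i.e. the multiplicative inverse of (e^x - 1)/x = Σ_{i≥0} x^i/(i+1)!.
-- Inverse-series recursion: c_0 = 1 and for m ≥ 1
--   Σ_{k=0}^{m} c_k / (m-k+1)! = 0.
-- revCoeffs m = [c_m, c_{m-1}, …, c_0].
revCoeffs : ℕ → List ℚ
revCoeffs zero    = 1ℚ ∷ []
revCoeffs (suc m) =
  - foldr _+_ 0ℚ (zipWith _*_ (revCoeffs m) (map (λ i → inv ((suc (suc i)) !)) (upTo (suc m))))
  ∷ revCoeffs m

headℚ : List ℚ → ℚ
headℚ []      = 0ℚ
headℚ (x ∷ _) = x

egfCoeff : ℕ → ℚ
egfCoeff m = headℚ (revCoeffs m)

-- Bernoulli numbers: x/(e^x-1) = Σ B_m x^m / m!, so B_m = m! · c_m.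
B : ℕ → ℚ
B m = ℕ→ℚ (m !) * egfCoeff m

a : ℕ → ℚ
a n = (ℕ→ℚ n * inv 2) * (ℕ→ℚ ((2 ℕ.* n ∸ 2) !) * inv ((n ∸ 1) ! ℕ.* (n ∸ 1) !))

b : ℕ → ℚ
b n = ℕ→ℚ ((2 ℕ.* n) !) * inv (2 ℕ.* (n ∸ 1) !)

S₁ : ℕ → ℚ
S₁ n = Σ< (suc (n ℕ./ 2)) (λ k →
  B (2 ℕ.* k) * inv ((2 ℕ.* k) ! ℕ.* (n ∸ 2 ℕ.* k) ! ℕ.* (n ∸ k)))

S₂ : ℕ → ℚ
S₂ n = Σ< (suc (n ℕ./ 2)) (λ k →
  (B (2 ℕ.* k) * inv ((2 ℕ.* k) ! ℕ.* (n ∸ 2 ℕ.* k) !)) *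
  Σ< (suc (n ℕ./ 2)) (λ j →
    (B (2 ℕ.* j) * inv ((2 ℕ.* j) ! ℕ.* (n ∸ 2 ℕ.* j) !)) *
    inv (2 ℕ.* n ∸ 2 ℕ.* k ∸ 2 ℕ.* j ℕ.+ 1)))

{-# OPTIONS --safe #-}
-- Let βₙ(x) = Bₙ(x)/n! = Σⱼ c_{n−j} xʲ/j!, where c_m = B_m/m!.  Since β′ₙ₊₁ = βₙ and
-- βₙ(0) = βₙ(1) = cₙ for n ≥ 2, repeated integration by parts gives
-- ∫₀¹ βₘ₊₁ βₙ₊₁ = (−1)ⁿ c_{m+n+2}; in particular B_{2n} = (−1)ⁿ⁻¹ (2n)! ∫₀¹ βₙ², and
-- comparing ∫₀¹ β₁ βₙ with ∫₀¹ βₙ β₁ shows that c_m = 0 for odd m ≥ 3.  Hence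
-- βₙ = ρₙ + r xⁿ⁻¹ with r = c₁/(n−1)! and ρₙ the sum of the even-index terms, and
-- expanding ∫₀¹ βₙ² = ∫₀¹ ρₙ² + 2r ∫₀¹ ρₙ xⁿ⁻¹ + r²/(2n−1) gives the formula:
-- S₂ = ∫₀¹ ρₙ², S₁ = 2 ∫₀¹ ρₙ xⁿ⁻¹, a_n = (2n)! r²/(2n−1) and b_n = −(2n)! r.
module Submission where

open import Defs

module BernoulliIntegrals where

  open import Function using (id)
  open import Data.Nat as ℕ using (ℕ; zero; suc; _∸_; _!; _≤_; _<_; z≤n; s≤s; NonZero)
  import Data.Nat.Properties as ℕ
  open import Data.Nat.DivMod using (m≡m%n+[m/n]*n; m%n<n; m/n*n≤m)
  open import Data.Nat.Tactic.RingSolver using (solve-∀)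
  import Data.Integer as ℤ
  import Data.Integer.Properties as ℤ
  import Data.Integer.GCD as ℤ
  open import Data.Rational using (ℚ; _/_; 0ℚ; 1ℚ; ½; _+_; _*_; -_; _-_; toℚᵘ; ↥_; ↧_)
  import Data.Rational.Properties as ℚ
  open import Data.Rational.Unnormalised as ℚᵘ using (mkℚᵘ; *≡*) renaming (_≃_ to _≃ᵘ_)
  import Data.Rational.Unnormalised.Properties as ℚᵘ
  open import Data.Rational.Solver using (module +-*-Solver)
  open +-*-Solver using (solve; _:=_; _:*_; _:+_; _:-_; :-_; con)
  open import Data.List using (_∷_; map; upTo; foldr; applyUpTo; zipWith)
  open import Data.Sum using (_⊎_; inj₁; inj₂)
  open import Relation.Binary.PropositionalEquality
  open ≡-Reasoning

  toℚᵘ-/ : ∀ (i : ℤ.ℤ) n → toℚᵘ (i / suc n) ≃ᵘ mkℚᵘ i n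
  toℚᵘ-/ i n = *≡* (begin
      ℚᵘ.↥ (toℚᵘ p) ℤ.* ℤ.+ suc n  ≡⟨ cong (ℤ._* ℤ.+ suc n) (ℚ.↥ᵘ-toℚᵘ p) ⟩
      ↥ p ℤ.* ℤ.+ suc n          ≡⟨ cong (↥ p ℤ.*_) (ℚ.↧-/ i (suc n)) ⟨
      ↥ p ℤ.* (↧ p ℤ.* g)        ≡⟨ cong (↥ p ℤ.*_) (ℤ.*-comm (↧ p) g) ⟩
      ↥ p ℤ.* (g ℤ.* ↧ p)        ≡⟨ ℤ.*-assoc (↥ p) g (↧ p) ⟨
      ↥ p ℤ.* g ℤ.* ↧ p          ≡⟨ cong (ℤ._* ↧ p) (ℚ.↥-/ i (suc n)) ⟩
      i ℤ.* ↧ p                  ≡⟨ cong (i ℤ.*_) (ℚ.↧ᵘ-toℚᵘ p) ⟨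
      i ℤ.* ℚᵘ.↧ (toℚᵘ p)        ∎)
    where
    p : ℚ
    p = i / suc n
    g : ℤ.ℤ
    g = ℤ.gcd i (ℤ.+ suc n)

  ℕ→ℚ-+ : ∀ m n → ℕ→ℚ (m ℕ.+ n) ≡ ℕ→ℚ m + ℕ→ℚ n
  ℕ→ℚ-+ m n = ℚ.toℚᵘ-injective (ℚᵘ.≃-trans (toℚᵘ-/ (ℤ.+ (m ℕ.+ n)) 0) (ℚᵘ.≃-trans (*≡* [m+n]*1≡)
    (ℚᵘ.≃-sym (ℚᵘ.≃-trans (ℚ.toℚᵘ-homo-+ (ℕ→ℚ m) (ℕ→ℚ n)) (ℚᵘ.+-cong (toℚᵘ-/ (ℤ.+ m) 0) (toℚᵘ-/ (ℤ.+ n) 0))))))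
    where
    [m+n]*1≡ : ℤ.+ (m ℕ.+ n) ℤ.* ℤ.+ 1 ≡ (ℤ.+ m ℤ.* ℤ.+ 1 ℤ.+ ℤ.+ n ℤ.* ℤ.+ 1) ℤ.* ℤ.+ 1
    [m+n]*1≡ = begin
      ℤ.+ (m ℕ.+ n) ℤ.* ℤ.+ 1                        ≡⟨ ℤ.*-identityʳ _ ⟩
      ℤ.+ (m ℕ.+ n)                                  ≡⟨ ℤ.pos-+ m n ⟩
      ℤ.+ m ℤ.+ ℤ.+ n                                ≡⟨ cong₂ ℤ._+_ (ℤ.*-identityʳ (ℤ.+ m)) (ℤ.*-identityʳ (ℤ.+ n)) ⟨
      ℤ.+ m ℤ.* ℤ.+ 1 ℤ.+ ℤ.+ n ℤ.* ℤ.+ 1            ≡⟨ ℤ.*-identityʳ _ ⟨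
      (ℤ.+ m ℤ.* ℤ.+ 1 ℤ.+ ℤ.+ n ℤ.* ℤ.+ 1) ℤ.* ℤ.+ 1 ∎

  ℕ→ℚ-* : ∀ m n → ℕ→ℚ (m ℕ.* n) ≡ ℕ→ℚ m * ℕ→ℚ n
  ℕ→ℚ-* m n = ℚ.toℚᵘ-injective (ℚᵘ.≃-trans (toℚᵘ-/ (ℤ.+ (m ℕ.* n)) 0)
    (ℚᵘ.≃-trans (ℚᵘ.≃-reflexive (cong (λ i → mkℚᵘ i 0) (ℤ.pos-* m n)))
    (ℚᵘ.≃-sym (ℚᵘ.≃-trans (ℚ.toℚᵘ-homo-* (ℕ→ℚ m) (ℕ→ℚ n)) (ℚᵘ.*-cong (toℚᵘ-/ (ℤ.+ m) 0) (toℚᵘ-/ (ℤ.+ n) 0))))))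

  ℕ→ℚ-*-inv : ∀ n .{{_ : NonZero n}} → ℕ→ℚ n * inv n ≡ 1ℚ
  ℕ→ℚ-*-inv (suc n) = ℚ.toℚᵘ-injective (ℚᵘ.≃-trans (ℚ.toℚᵘ-homo-* (ℕ→ℚ (suc n)) (inv (suc n)))
    (ℚᵘ.≃-trans (ℚᵘ.*-cong (toℚᵘ-/ (ℤ.+ suc n) 0) (toℚᵘ-/ (ℤ.+ 1) n)) (ℚᵘ.≃-trans (*≡* [1+n]*1*1≡) (ℚᵘ.≃-sym (toℚᵘ-/ (ℤ.+ 1) 0)))))
    where
    [1+n]*1*1≡ : (ℤ.+ suc n ℤ.* ℤ.+ 1) ℤ.* ℤ.+ 1 ≡ ℤ.+ 1 ℤ.* ℤ.+ (1 ℕ.* suc n)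
    [1+n]*1*1≡ = begin
      (ℤ.+ suc n ℤ.* ℤ.+ 1) ℤ.* ℤ.+ 1  ≡⟨ ℤ.*-identityʳ _ ⟩
      ℤ.+ suc n ℤ.* ℤ.+ 1            ≡⟨ ℤ.*-comm (ℤ.+ suc n) (ℤ.+ 1) ⟩
      ℤ.+ 1 ℤ.* ℤ.+ suc n            ≡⟨ cong (λ k → ℤ.+ 1 ℤ.* ℤ.+ k) (ℕ.*-identityˡ (suc n)) ⟨
      ℤ.+ 1 ℤ.* ℤ.+ (1 ℕ.* suc n)    ∎

  inv-* : ∀ m n .{{_ : NonZero m}} .{{_ : NonZero n}} → inv (m ℕ.* n) ≡ inv m * inv n
  inv-* m n {{m≢0}} {{n≢0}} = begin
      u                             ≡⟨ solve 1 (λ u → u := u :* con 1ℚ :* con 1ℚ) refl u ⟩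
      u * 1ℚ * 1ℚ                   ≡⟨ cong₂ (λ p q → u * p * q) (ℕ→ℚ-*-inv m) (ℕ→ℚ-*-inv n) ⟨
      u * (M * iM) * (N * iN)       ≡⟨ solve 5 (λ u M iM N iN → u :* (M :* iM) :* (N :* iN) := (M :* N :* u) :* (iM :* iN)) refl u M (inv m) N (inv n) ⟩
      (M * N * u) * (iM * iN)       ≡⟨ cong (λ x → x * u * (iM * iN)) (ℕ→ℚ-* m n) ⟨
      ℕ→ℚ (m ℕ.* n) * u * (iM * iN) ≡⟨ cong (_* (iM * iN)) (ℕ→ℚ-*-inv (m ℕ.* n) {{ℕ.m*n≢0 m n {{m≢0}} {{n≢0}}}}) ⟩
      1ℚ * (iM * iN)                ≡⟨ ℚ.*-identityˡ _ ⟩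
      iM * iN                       ∎
    where
    u M N iM iN : ℚ
    u = inv (m ℕ.* n)
    M = ℕ→ℚ m
    N = ℕ→ℚ n
    iM = inv m
    iN = inv n

  [1+n]*inv[1+n]!≡inv[n!] : ∀ n → ℕ→ℚ (suc n) * inv (suc n !) ≡ inv (n !)
  [1+n]*inv[1+n]!≡inv[n!] n = begin
      ℕ→ℚ (suc n) * inv (suc n ℕ.* n !)         ≡⟨ cong (ℕ→ℚ (suc n) *_) (inv-* (suc n) (n !) {{_}} {{n ℕ.!≢0}}) ⟩
      ℕ→ℚ (suc n) * (inv (suc n) * inv (n !))   ≡⟨ ℚ.*-assoc (ℕ→ℚ (suc n)) (inv (suc n)) (inv (n !)) ⟨
      ℕ→ℚ (suc n) * inv (suc n) * inv (n !)     ≡⟨ cong (_* inv (n !)) (ℕ→ℚ-*-inv (suc n)) ⟩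
      1ℚ * inv (n !)                            ≡⟨ ℚ.*-identityˡ _ ⟩
      inv (n !)                                 ∎

  neg1^-even : ∀ k → neg1^ (2 ℕ.* k) ≡ 1ℚ
  neg1^-even zero    = refl
  neg1^-even (suc k) = begin
      neg1^ (2 ℕ.* suc k)        ≡⟨ cong neg1^ (ℕ.*-suc 2 k) ⟩
      - - neg1^ (2 ℕ.* k)        ≡⟨ solve 1 (λ x → :- (:- x) := x) refl (neg1^ (2 ℕ.* k)) ⟩
      neg1^ (2 ℕ.* k)            ≡⟨ neg1^-even k ⟩
      1ℚ                         ∎

  neg1^-cancel : ∀ m x → neg1^ m * (neg1^ m * x) ≡ x
  neg1^-cancel zero    x = trans (ℚ.*-identityˡ _) (ℚ.*-identityˡ x)
  neg1^-cancel (suc m) x = trans (solve 2 (λ s x → (:- s) :* ((:- s) :* x) := s :* (s :* x)) refl (neg1^ m) x) (neg1^-cancel m x)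

  x≡-x⇒x≡0 : ∀ x → x ≡ - x → x ≡ 0ℚ
  x≡-x⇒x≡0 x x≡-x = begin
      x                  ≡⟨ solve 1 (λ x → x := con ½ :* x :+ con ½ :* x) refl x ⟩
      ½ * x + ½ * x      ≡⟨ cong (λ y → ½ * x + ½ * y) x≡-x ⟩
      ½ * x + ½ * - x    ≡⟨ solve 1 (λ x → con ½ :* x :+ con ½ :* (:- x) := con 0ℚ) refl x ⟩
      0ℚ                 ∎

  x+y≡z⇒x≡z-y : ∀ {x y z} → x + y ≡ z → x ≡ z - y
  x+y≡z⇒x≡z-y {x} {y} refl = solve 2 (λ x y → x := (x :+ y) :- y) refl x y

  ∑ : ℕ → (ℕ → ℚ) → ℚ
  ∑ zero    f = 0ℚ
  ∑ (suc n) f = f 0 + ∑ n (λ i → f (suc i))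

  foldr-map-applyUpTo : ∀ n (f : ℕ → ℚ) (g : ℕ → ℕ) → foldr _+_ 0ℚ (map f (applyUpTo g n)) ≡ ∑ n (λ i → f (g i))
  foldr-map-applyUpTo zero    f g = refl
  foldr-map-applyUpTo (suc n) f g = cong (f (g 0) +_) (foldr-map-applyUpTo n f (λ i → g (suc i)))

  Σ<≡∑ : ∀ n f → Σ< n f ≡ ∑ n f
  Σ<≡∑ n f = foldr-map-applyUpTo n f id

  ∑-cong-< : ∀ n {f g : ℕ → ℚ} → (∀ i → i < n → f i ≡ g i) → ∑ n f ≡ ∑ n g
  ∑-cong-< zero    f≡g = refl
  ∑-cong-< (suc n) f≡g = cong₂ _+_ (f≡g 0 (s≤s z≤n)) (∑-cong-< n (λ i i<n → f≡g (suc i) (s≤s i<n)))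

  ∑-cong : ∀ n {f g : ℕ → ℚ} → (∀ i → f i ≡ g i) → ∑ n f ≡ ∑ n g
  ∑-cong n f≡g = ∑-cong-< n (λ i _ → f≡g i)

  ∑-zero : ∀ n → ∑ n (λ _ → 0ℚ) ≡ 0ℚ
  ∑-zero zero    = refl
  ∑-zero (suc n) = cong (0ℚ +_) (∑-zero n)

  ∑-+ : ∀ n (f g : ℕ → ℚ) → ∑ n (λ i → f i + g i) ≡ ∑ n f + ∑ n g
  ∑-+ zero    f g = refl
  ∑-+ (suc n) f g = trans (cong ((f 0 + g 0) +_) (∑-+ n _ _))
    (solve 4 (λ a b c d → (a :+ b) :+ (c :+ d) := (a :+ c) :+ (b :+ d)) refl (f 0) (g 0) _ _)

  ∑-distribˡ-* : ∀ n r (f : ℕ → ℚ) → ∑ n (λ i → r * f i) ≡ r * ∑ n f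
  ∑-distribˡ-* zero    r f = sym (ℚ.*-zeroʳ r)
  ∑-distribˡ-* (suc n) r f = trans (cong ((r * f 0) +_) (∑-distribˡ-* n r _)) (sym (ℚ.*-distribˡ-+ r (f 0) _))

  ∑-last : ∀ n (f : ℕ → ℚ) → ∑ (suc n) f ≡ ∑ n f + f n
  ∑-last zero    f = trans (ℚ.+-identityʳ (f 0)) (sym (ℚ.+-identityˡ (f 0)))
  ∑-last (suc n) f = trans (cong (f 0 +_) (∑-last n (λ i → f (suc i)))) (sym (ℚ.+-assoc (f 0) _ _))

  ∑-comm : ∀ m n (f : ℕ → ℕ → ℚ) → ∑ m (λ i → ∑ n (λ j → f i j)) ≡ ∑ n (λ j → ∑ m (λ i → f i j))
  ∑-comm zero    n f = sym (∑-zero n)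
  ∑-comm (suc m) n f = trans (cong (∑ n (f 0) +_) (∑-comm m n (λ i → f (suc i))))
    (sym (∑-+ n (f 0) (λ j → ∑ m (λ i → f (suc i) j))))

  ∑-reverse : ∀ n (f : ℕ → ℚ) → ∑ (suc n) f ≡ ∑ (suc n) (λ i → f (n ∸ i))
  ∑-reverse zero    f = refl
  ∑-reverse (suc n) f = begin
      f 0 + ∑ (suc n) (λ i → f (suc i))                ≡⟨ cong (f 0 +_) (∑-reverse n (λ i → f (suc i))) ⟩
      f 0 + ∑ (suc n) (λ i → f (suc (n ∸ i)))          ≡⟨ ℚ.+-comm (f 0) _ ⟩
      ∑ (suc n) (λ i → f (suc (n ∸ i))) + f 0          ≡⟨ cong (_+ f 0) (∑-cong-< (suc n) (λ i i≤n → cong f (ℕ.+-∸-assoc 1 (ℕ.s≤s⁻¹ i≤n)))) ⟨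
      ∑ (suc n) (λ i → f (suc n ∸ i)) + f 0            ≡⟨ cong (λ k → ∑ (suc n) (λ i → f (suc n ∸ i)) + f k) (ℕ.n∸n≡0 (suc n)) ⟨
      ∑ (suc n) (λ i → f (suc n ∸ i)) + f (suc n ∸ suc n) ≡⟨ ∑-last (suc n) (λ i → f (suc n ∸ i)) ⟨
      ∑ (suc (suc n)) (λ i → f (suc n ∸ i))            ∎

  ∑-even-odd : ∀ m (f : ℕ → ℚ) →
    ∑ (2 ℕ.* m) f ≡ ∑ m (λ k → f (2 ℕ.* k)) + ∑ m (λ k → f (suc (2 ℕ.* k)))
  ∑-even-odd zero    f = refl
  ∑-even-odd (suc m) f = begin
      ∑ (2 ℕ.* suc m) f                                        ≡⟨ cong (λ l → ∑ l f) (ℕ.*-suc 2 m) ⟩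
      f 0 + (f 1 + ∑ (2 ℕ.* m) (λ i → f (suc (suc i))))        ≡⟨ cong (λ s → f 0 + (f 1 + s)) (∑-even-odd m _) ⟩
      f 0 + (f 1 + (∑ m (λ k → f (2+2k k)) + ∑ m (λ k → f (suc (2+2k k)))))
        ≡⟨ solve 4 (λ a b c d → a :+ (b :+ (c :+ d)) := (a :+ c) :+ (b :+ d)) refl (f 0) (f 1) _ _ ⟩
      (f 0 + ∑ m (λ k → f (2+2k k))) + (f 1 + ∑ m (λ k → f (suc (2+2k k))))
        ≡⟨ cong₂ (λ e o → (f 0 + e) + (f 1 + o)) (∑-cong m (λ k → cong f (ℕ.*-suc 2 k))) (∑-cong m (λ k → cong (λ i → f (suc i)) (ℕ.*-suc 2 k))) ⟨
      ∑ (suc m) (λ k → f (2 ℕ.* k)) + ∑ (suc m) (λ k → f (suc (2 ℕ.* k))) ∎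
    where
    2+2k : ℕ → ℕ
    2+2k k = suc (suc (2 ℕ.* k))

  ∑-head : ∀ n (f : ℕ → ℚ) → (∀ i → f (suc i) ≡ 0ℚ) → ∑ (suc n) f ≡ f 0
  ∑-head n f tail≡0 = trans (cong (f 0 +_) (trans (∑-cong n tail≡0) (∑-zero n))) (ℚ.+-identityʳ (f 0))

  ∑-odd-vanishing : ∀ {n} h (f : ℕ → ℚ) → 2 ℕ.* h ≡ n ⊎ suc (2 ℕ.* h) ≡ n → 1 ≤ n →
    (∀ k → f (suc (2 ℕ.* suc k)) ≡ 0ℚ) →
    ∑ (suc n) f ≡ ∑ (suc h) (λ k → f (2 ℕ.* k)) + f 1
  ∑-odd-vanishing zero    f (inj₁ refl) ()
  ∑-odd-vanishing (suc h) f (inj₁ refl) _ odd≡0 = begin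
      ∑ (suc (2 ℕ.* suc h)) f                                ≡⟨ ∑-last (2 ℕ.* suc h) f ⟩
      ∑ (2 ℕ.* suc h) f + f (2 ℕ.* suc h)                    ≡⟨ cong (_+ f (2 ℕ.* suc h)) (∑-even-odd (suc h) f) ⟩
      (∑ (suc h) evens + ∑ (suc h) odds) + f (2 ℕ.* suc h)   ≡⟨ cong (λ o → (∑ (suc h) evens + o) + f (2 ℕ.* suc h)) (∑-head h odds odd≡0) ⟩
      (∑ (suc h) evens + f 1) + f (2 ℕ.* suc h)
        ≡⟨ solve 3 (λ e x y → (e :+ x) :+ y := (e :+ y) :+ x) refl (∑ (suc h) evens) (f 1) (f (2 ℕ.* suc h)) ⟩
      (∑ (suc h) evens + f (2 ℕ.* suc h)) + f 1              ≡⟨ cong (_+ f 1) (∑-last (suc h) evens) ⟨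
      ∑ (suc (suc h)) evens + f 1                            ∎
    where
    evens odds : ℕ → ℚ
    evens k = f (2 ℕ.* k)
    odds k = f (suc (2 ℕ.* k))
  ∑-odd-vanishing h f (inj₂ refl) _ odd≡0 = begin
      ∑ (suc (suc (2 ℕ.* h))) f           ≡⟨ cong (λ l → ∑ l f) (ℕ.*-suc 2 h) ⟨
      ∑ (2 ℕ.* suc h) f                   ≡⟨ ∑-even-odd (suc h) f ⟩
      ∑ (suc h) evens + ∑ (suc h) odds    ≡⟨ cong (∑ (suc h) evens +_) (∑-head h odds odd≡0) ⟩
      ∑ (suc h) evens + f 1               ∎
    where
    evens odds : ℕ → ℚ
    evens k = f (2 ℕ.* k)
    odds k = f (suc (2 ℕ.* k))

  -- A polynomial Σⱼ pⱼ xʲ is represented by the functional φ ↦ Σⱼ pⱼ φ j, i.e. xʲ is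
  -- replaced by φ j.  Evaluation at 1 and at 0 and the integral ∫₀¹ p q are all of
  -- this form, for the sequences ev₁, ev₀ and j ↦ ∫₀¹ xʲ q.

  Functional : Set
  Functional = (ℕ → ℚ) → ℚ

  record IsLinear (P : Functional) : Set where
    field
      extensional : ∀ {φ ψ : ℕ → ℚ} → (∀ j → φ j ≡ ψ j) → P φ ≡ P ψ
      additive    : ∀ (φ ψ : ℕ → ℚ) → P (λ j → φ j + ψ j) ≡ P φ + P ψ
      homogeneous : ∀ r (φ : ℕ → ℚ) → P (λ j → r * φ j) ≡ r * P φ

    subtractive : ∀ (φ ψ : ℕ → ℚ) → P (λ j → φ j - ψ j) ≡ P φ - P ψ
    subtractive φ ψ = begin
        P (λ j → φ j - ψ j)            ≡⟨ extensional (λ j → solve 2 (λ x y → x :- y := x :+ con (- 1ℚ) :* y) refl (φ j) (ψ j)) ⟩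
        P (λ j → φ j + (- 1ℚ) * ψ j)   ≡⟨ additive φ (λ j → (- 1ℚ) * ψ j) ⟩
        P φ + P (λ j → (- 1ℚ) * ψ j)   ≡⟨ cong (P φ +_) (homogeneous (- 1ℚ) ψ) ⟩
        P φ + (- 1ℚ) * P ψ             ≡⟨ solve 2 (λ x y → x :+ con (- 1ℚ) :* y := x :- y) refl (P φ) (P ψ) ⟩
        P φ - P ψ                      ∎

  linearCombination : ℕ → (ℕ → ℚ) → (ℕ → ℕ) → Functional
  linearCombination N w e φ = ∑ N (λ i → w i * φ (e i))

  linearCombination-isLinear : ∀ N w e → IsLinear (linearCombination N w e)
  linearCombination-isLinear N w e = record
    { extensional = λ φ≡ψ → ∑-cong N (λ i → cong (w i *_) (φ≡ψ (e i)))
    ; additive    = λ φ ψ → trans (∑-cong N (λ i → ℚ.*-distribˡ-+ (w i) (φ (e i)) (ψ (e i)))) (∑-+ N _ _)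
    ; homogeneous = λ r φ → trans (∑-cong N (λ i → solve 3 (λ a b c → a :* (b :* c) := b :* (a :* c)) refl (w i) r (φ (e i))))
                                  (∑-distribˡ-* N r _)
    }

  monomial : ℕ → Functional
  monomial j φ = φ j

  ev₁ ev₀ : ℕ → ℚ
  ev₁ _       = 1ℚ
  ev₀ zero    = 1ℚ
  ev₀ (suc _) = 0ℚ

  -- ∫₀¹ xⁱ xʲ dx
  moment : ℕ → ℕ → ℚ
  moment i j = inv (suc (i ℕ.+ j))

  moment-comm : ∀ i j → moment i j ≡ moment j i
  moment-comm i j = cong (λ k → inv (suc k)) (ℕ.+-comm i j)

  ∫[_·_] : Functional → Functional → ℚ
  ∫[ P · Q ] = P (λ i → Q (moment i))

  -- The j = 0 term carries the factor 0, so the truncation j ∸ 1 there is harmless.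
  derivative : Functional → Functional
  derivative P φ = P (λ j → ℕ→ℚ j * φ (j ∸ 1))

  moment-by-parts : ∀ i j → ℕ→ℚ i * moment (i ∸ 1) j + ℕ→ℚ j * moment i (j ∸ 1) ≡ 1ℚ - ev₀ i * ev₀ j
  moment-by-parts zero    zero    = refl
  moment-by-parts zero    (suc j) = trans (cong (_+ ℕ→ℚ (suc j) * inv (suc j)) (ℚ.*-zeroˡ (moment 0 (suc j)))) (trans (ℚ.+-identityˡ _) (ℕ→ℚ-*-inv (suc j)))
  moment-by-parts (suc i) zero    = trans (cong (ℕ→ℚ (suc i) * moment i 0 +_) (ℚ.*-zeroˡ (moment (suc i) 0))) (trans (ℚ.+-identityʳ _) (begin
      ℕ→ℚ (suc i) * inv (suc (i ℕ.+ 0))   ≡⟨ cong (λ k → ℕ→ℚ (suc i) * inv (suc k)) (ℕ.+-identityʳ i) ⟩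
      ℕ→ℚ (suc i) * inv (suc i)           ≡⟨ ℕ→ℚ-*-inv (suc i) ⟩
      1ℚ                                  ∎))
  moment-by-parts (suc i) (suc j) = begin
      ℕ→ℚ (suc i) * inv (suc (i ℕ.+ suc j)) + ℕ→ℚ (suc j) * inv (suc (suc i ℕ.+ j))
        ≡⟨ cong (λ k → ℕ→ℚ (suc i) * inv (suc k) + ℕ→ℚ (suc j) * inv (suc (suc i ℕ.+ j))) (ℕ.+-suc i j) ⟩
      ℕ→ℚ (suc i) * inv N + ℕ→ℚ (suc j) * inv N   ≡⟨ ℚ.*-distribʳ-+ (inv N) (ℕ→ℚ (suc i)) (ℕ→ℚ (suc j)) ⟨
      (ℕ→ℚ (suc i) + ℕ→ℚ (suc j)) * inv N         ≡⟨ cong (_* inv N) (ℕ→ℚ-+ (suc i) (suc j)) ⟨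
      ℕ→ℚ (suc i ℕ.+ suc j) * inv N               ≡⟨ cong (λ k → ℕ→ℚ (suc k) * inv N) (ℕ.+-suc i j) ⟩
      ℕ→ℚ N * inv N                               ≡⟨ ℕ→ℚ-*-inv N ⟩
      1ℚ                                          ∎
    where
    N : ℕ
    N = suc (suc (i ℕ.+ j))

  ∫-by-parts : ∀ {P Q} → IsLinear P → IsLinear Q →
    ∫[ derivative P · Q ] + ∫[ P · derivative Q ] ≡ P ev₁ * Q ev₁ - P ev₀ * Q ev₀
  ∫-by-parts {P} {Q} P-lin Q-lin = begin
      P (λ i → ℕ→ℚ i * Q (moment (i ∸ 1))) + P (λ i → Q (λ j → ℕ→ℚ j * moment i (j ∸ 1)))
        ≡⟨ P.additive _ _ ⟨
      P (λ i → ℕ→ℚ i * Q (moment (i ∸ 1)) + Q (λ j → ℕ→ℚ j * moment i (j ∸ 1)))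
        ≡⟨ P.extensional (λ i → trans (Q.additive _ _) (cong (_+ Q (λ j → ℕ→ℚ j * moment i (j ∸ 1))) (Q.homogeneous (ℕ→ℚ i) (moment (i ∸ 1))))) ⟨
      P (λ i → Q (λ j → ℕ→ℚ i * moment (i ∸ 1) j + ℕ→ℚ j * moment i (j ∸ 1)))
        ≡⟨ P.extensional (λ i → Q.extensional (moment-by-parts i)) ⟩
      P (λ i → Q (λ j → 1ℚ - ev₀ i * ev₀ j))
        ≡⟨ P.extensional (λ i → trans (Q.subtractive ev₁ (λ j → ev₀ i * ev₀ j)) (cong (λ x → Q ev₁ - x) (Q.homogeneous (ev₀ i) ev₀))) ⟩
      P (λ i → Q ev₁ - ev₀ i * Q ev₀)
        ≡⟨ P.extensional (λ i → solve 3 (λ q d z → q :- d :* z := q :* con 1ℚ :- z :* d) refl (Q ev₁) (ev₀ i) (Q ev₀)) ⟩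
      P (λ i → Q ev₁ * ev₁ i - Q ev₀ * ev₀ i)
        ≡⟨ P.subtractive _ _ ⟩
      P (λ i → Q ev₁ * ev₁ i) - P (λ i → Q ev₀ * ev₀ i)
        ≡⟨ cong₂ _-_ (P.homogeneous (Q ev₁) ev₁) (P.homogeneous (Q ev₀) ev₀) ⟩
      Q ev₁ * P ev₁ - Q ev₀ * P ev₀
        ≡⟨ cong₂ _-_ (ℚ.*-comm (Q ev₁) (P ev₁)) (ℚ.*-comm (Q ev₀) (P ev₀)) ⟩
      P ev₁ * Q ev₁ - P ev₀ * Q ev₀
        ∎
    where
    module P = IsLinear P-lin
    module Q = IsLinear Q-lin

  ∫-comm : ∀ M v e N w f →
    ∫[ linearCombination M v e · linearCombination N w f ] ≡ ∫[ linearCombination N w f · linearCombination M v e ]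
  ∫-comm M v e N w f = begin
      ∑ M (λ i → v i * ∑ N (λ j → w j * moment (e i) (f j)))
        ≡⟨ ∑-cong M (λ i → ∑-distribˡ-* N (v i) _) ⟨
      ∑ M (λ i → ∑ N (λ j → v i * (w j * moment (e i) (f j))))
        ≡⟨ ∑-comm M N _ ⟩
      ∑ N (λ j → ∑ M (λ i → v i * (w j * moment (e i) (f j))))
        ≡⟨ ∑-cong N (λ j → ∑-cong M (λ i → trans (cong (λ x → v i * (w j * x)) (moment-comm (e i) (f j)))
                                                  (solve 3 (λ a b k → a :* (b :* k) := b :* (a :* k)) refl (v i) (w j) _))) ⟩
      ∑ N (λ j → ∑ M (λ i → w j * (v i * moment (f j) (e i))))
        ≡⟨ ∑-cong N (λ j → ∑-distribˡ-* M (w j) _) ⟩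
      ∑ N (λ j → w j * ∑ M (λ i → v i * moment (f j) (e i)))
        ∎

  -- bernoulliPoly n is βₙ = Bₙ(x)/n!.

  bernoulliCoeff : ℕ → ℕ → ℚ
  bernoulliCoeff n j = egfCoeff (n ∸ j) * inv (j !)

  bernoulliPoly : ℕ → Functional
  bernoulliPoly n = linearCombination (suc n) (bernoulliCoeff n) id

  bernoulliPoly-isLinear : ∀ n → IsLinear (bernoulliPoly n)
  bernoulliPoly-isLinear n = linearCombination-isLinear (suc n) (bernoulliCoeff n) id

  derivative-bernoulliPoly : ∀ n φ → derivative (bernoulliPoly (suc n)) φ ≡ bernoulliPoly n φ
  derivative-bernoulliPoly n φ = begin
      egfCoeff (suc n) * 1ℚ * (ℕ→ℚ 0 * φ 0) + ∑ (suc n) (λ j → egfCoeff (n ∸ j) * inv (suc j !) * (ℕ→ℚ (suc j) * φ j))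
        ≡⟨ cong (_+ ∑ (suc n) (λ j → egfCoeff (n ∸ j) * inv (suc j !) * (ℕ→ℚ (suc j) * φ j))) (solve 2 (λ x y → x :* (con 0ℚ :* y) := con 0ℚ) refl (egfCoeff (suc n) * 1ℚ) (φ 0)) ⟩
      0ℚ + ∑ (suc n) (λ j → egfCoeff (n ∸ j) * inv (suc j !) * (ℕ→ℚ (suc j) * φ j))
        ≡⟨ ℚ.+-identityˡ _ ⟩
      ∑ (suc n) (λ j → egfCoeff (n ∸ j) * inv (suc j !) * (ℕ→ℚ (suc j) * φ j))
        ≡⟨ ∑-cong (suc n) lower-index ⟩
      ∑ (suc n) (λ j → egfCoeff (n ∸ j) * inv (j !) * φ j)
        ∎
    where
    lower-index : ∀ j → egfCoeff (n ∸ j) * inv (suc j !) * (ℕ→ℚ (suc j) * φ j) ≡ egfCoeff (n ∸ j) * inv (j !) * φ j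
    lower-index j = begin
        egfCoeff (n ∸ j) * inv (suc j !) * (ℕ→ℚ (suc j) * φ j)
          ≡⟨ solve 4 (λ c i k y → c :* i :* (k :* y) := c :* (k :* i) :* y) refl (egfCoeff (n ∸ j)) (inv (suc j !)) (ℕ→ℚ (suc j)) (φ j) ⟩
        egfCoeff (n ∸ j) * (ℕ→ℚ (suc j) * inv (suc j !)) * φ j
          ≡⟨ cong (λ x → egfCoeff (n ∸ j) * x * φ j) ([1+n]*inv[1+n]!≡inv[n!] j) ⟩
        egfCoeff (n ∸ j) * inv (j !) * φ j
          ∎

  bernoulliPoly-ev₀ : ∀ n → bernoulliPoly n ev₀ ≡ egfCoeff n
  bernoulliPoly-ev₀ n = begin
      egfCoeff n * 1ℚ * 1ℚ + ∑ n (λ j → egfCoeff (n ∸ suc j) * inv (suc j !) * 0ℚ)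
        ≡⟨ cong (egfCoeff n * 1ℚ * 1ℚ +_) (trans (∑-cong n (λ j → ℚ.*-zeroʳ (egfCoeff (n ∸ suc j) * inv (suc j !)))) (∑-zero n)) ⟩
      egfCoeff n * 1ℚ * 1ℚ + 0ℚ
        ≡⟨ solve 1 (λ c → c :* con 1ℚ :* con 1ℚ :+ con 0ℚ := c) refl (egfCoeff n) ⟩
      egfCoeff n
        ∎

  revCoeffs≡applyUpTo : ∀ m → revCoeffs m ≡ applyUpTo (λ i → egfCoeff (m ∸ i)) (suc m)
  revCoeffs≡applyUpTo zero    = refl
  revCoeffs≡applyUpTo (suc m) = cong (egfCoeff (suc m) ∷_) (revCoeffs≡applyUpTo m)

  foldr-zipWith-applyUpTo : ∀ n (f : ℕ → ℚ) (g : ℕ → ℕ) (h : ℕ → ℚ) →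
    foldr _+_ 0ℚ (zipWith _*_ (applyUpTo f n) (map h (applyUpTo g n))) ≡ ∑ n (λ i → f i * h (g i))
  foldr-zipWith-applyUpTo zero    f g h = refl
  foldr-zipWith-applyUpTo (suc n) f g h = cong (f 0 * h (g 0) +_) (foldr-zipWith-applyUpTo n (λ i → f (suc i)) (λ i → g (suc i)) h)

  egfCoeff-suc : ∀ m → egfCoeff (suc m) ≡ - ∑ (suc m) (λ i → egfCoeff (m ∸ i) * inv (suc (suc i) !))
  egfCoeff-suc m = cong -_ (begin
      foldr _+_ 0ℚ (zipWith _*_ (revCoeffs m) (map (λ i → inv (suc (suc i) !)) (upTo (suc m))))
        ≡⟨ cong (λ cs → foldr _+_ 0ℚ (zipWith _*_ cs (map (λ i → inv (suc (suc i) !)) (upTo (suc m))))) (revCoeffs≡applyUpTo m) ⟩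
      foldr _+_ 0ℚ (zipWith _*_ (applyUpTo (λ i → egfCoeff (m ∸ i)) (suc m)) (map (λ i → inv (suc (suc i) !)) (upTo (suc m))))
        ≡⟨ foldr-zipWith-applyUpTo (suc m) (λ i → egfCoeff (m ∸ i)) id (λ i → inv (suc (suc i) !)) ⟩
      ∑ (suc m) (λ i → egfCoeff (m ∸ i) * inv (suc (suc i) !))
        ∎)

  bernoulliPoly-ev₁ : ∀ m → bernoulliPoly (suc (suc m)) ev₁ ≡ egfCoeff (suc (suc m))
  bernoulliPoly-ev₁ m = begin
      c₂ * 1ℚ * 1ℚ + (egfCoeff (suc m) * 1ℚ * 1ℚ + ∑ (suc m) (λ i → egfCoeff (m ∸ i) * inv (suc (suc i) !) * 1ℚ))
        ≡⟨ cong₂ (λ x y → c₂ * 1ℚ * 1ℚ + (x * 1ℚ * 1ℚ + y)) (egfCoeff-suc m) (∑-cong (suc m) (λ i → ℚ.*-identityʳ (egfCoeff (m ∸ i) * inv (suc (suc i) !)))) ⟩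
      c₂ * 1ℚ * 1ℚ + (- S * 1ℚ * 1ℚ + S)
        ≡⟨ solve 2 (λ x s → x :* con 1ℚ :* con 1ℚ :+ ((:- s) :* con 1ℚ :* con 1ℚ :+ s) := x) refl c₂ S ⟩
      c₂
        ∎
    where
    c₂ S : ℚ
    c₂ = egfCoeff (suc (suc m))
    S = ∑ (suc m) (λ i → egfCoeff (m ∸ i) * inv (suc (suc i) !))

  ∫B : ℕ → ℕ → ℚ
  ∫B m n = ∫[ bernoulliPoly m · bernoulliPoly n ]

  ∫B-comm : ∀ m n → ∫B m n ≡ ∫B n m
  ∫B-comm m n = ∫-comm (suc m) (bernoulliCoeff m) id (suc n) (bernoulliCoeff n) id

  ∫B-by-parts : ∀ m n → ∫B m (suc n) + ∫B (suc m) n ≡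
    bernoulliPoly (suc m) ev₁ * bernoulliPoly (suc n) ev₁ - egfCoeff (suc m) * egfCoeff (suc n)
  ∫B-by-parts m n = begin
      ∫B m (suc n) + ∫B (suc m) n
        ≡⟨ cong₂ _+_ (derivative-bernoulliPoly m (λ i → Q (moment i)))
                     (IsLinear.extensional (bernoulliPoly-isLinear (suc m)) (λ i → derivative-bernoulliPoly n (moment i))) ⟨
      ∫[ derivative P · Q ] + ∫[ P · derivative Q ]
        ≡⟨ ∫-by-parts (bernoulliPoly-isLinear (suc m)) (bernoulliPoly-isLinear (suc n)) ⟩
      P ev₁ * Q ev₁ - P ev₀ * Q ev₀
        ≡⟨ cong₂ (λ x y → P ev₁ * Q ev₁ - x * y) (bernoulliPoly-ev₀ (suc m)) (bernoulliPoly-ev₀ (suc n)) ⟩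
      P ev₁ * Q ev₁ - egfCoeff (suc m) * egfCoeff (suc n)
        ∎
    where
    P Q : Functional
    P = bernoulliPoly (suc m)
    Q = bernoulliPoly (suc n)

  -- ∫₀¹ βₘ₊₁ = βₘ₊₂(1) − βₘ₊₂(0), by parts against the constant β₀ = 1.
  ∫B-zeroʳ : ∀ m → ∫B (suc m) 0 ≡ 0ℚ
  ∫B-zeroʳ m = begin
      ∫B (suc m) 0
        ≡⟨ derivative-bernoulliPoly (suc m) (λ i → Q (moment i)) ⟨
      ∫[ derivative P · Q ]
        ≡⟨ ℚ.+-identityʳ _ ⟨
      ∫[ derivative P · Q ] + 0ℚ
        ≡⟨ cong (∫[ derivative P · Q ] +_) ∫[P·Q′]≡0 ⟨
      ∫[ derivative P · Q ] + ∫[ P · derivative Q ]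
        ≡⟨ ∫-by-parts P-lin (bernoulliPoly-isLinear 0) ⟩
      P ev₁ * 1ℚ - P ev₀ * 1ℚ
        ≡⟨ cong₂ (λ x y → x * 1ℚ - y * 1ℚ) (bernoulliPoly-ev₁ m) (bernoulliPoly-ev₀ (suc (suc m))) ⟩
      egfCoeff (suc (suc m)) * 1ℚ - egfCoeff (suc (suc m)) * 1ℚ
        ≡⟨ solve 1 (λ c → c :* con 1ℚ :- c :* con 1ℚ := con 0ℚ) refl (egfCoeff (suc (suc m))) ⟩
      0ℚ
        ∎
    where
    P Q : Functional
    P = bernoulliPoly (suc (suc m))
    Q = bernoulliPoly 0
    P-lin : IsLinear P
    P-lin = bernoulliPoly-isLinear (suc (suc m))
    ∫[P·Q′]≡0 : ∫[ P · derivative Q ] ≡ 0ℚ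
    ∫[P·Q′]≡0 = begin
        P (λ i → derivative Q (moment i))
          ≡⟨ IsLinear.extensional P-lin (λ i → solve 1 (λ y → con 1ℚ :* con 1ℚ :* (con 0ℚ :* y) :+ con 0ℚ := con 0ℚ :* con 0ℚ) refl (moment i 0)) ⟩
        P (λ _ → 0ℚ * 0ℚ)
          ≡⟨ IsLinear.homogeneous P-lin 0ℚ (λ _ → 0ℚ) ⟩
        0ℚ * P (λ _ → 0ℚ)
          ≡⟨ ℚ.*-zeroˡ (P (λ _ → 0ℚ)) ⟩
        0ℚ
          ∎

  ∫B-suc-suc : ∀ n m → ∫B (suc m) (suc n) ≡ neg1^ n * egfCoeff (suc (suc (m ℕ.+ n)))
  ∫B-suc-suc zero m = begin
      ∫B (suc m) 1
        ≡⟨ x+y≡z⇒x≡z-y (∫B-by-parts (suc m) 0) ⟩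
      bernoulliPoly (suc (suc m)) ev₁ * bernoulliPoly 1 ev₁ - c * egfCoeff 1 - ∫B (suc (suc m)) 0
        ≡⟨ cong₂ (λ x y → x * bernoulliPoly 1 ev₁ - c * egfCoeff 1 - y) (bernoulliPoly-ev₁ m) (∫B-zeroʳ (suc m)) ⟩
      c * (egfCoeff 1 + 1ℚ) - c * egfCoeff 1 - 0ℚ
        ≡⟨ solve 2 (λ x y → x :* (y :+ con 1ℚ) :- x :* y :- con 0ℚ := con 1ℚ :* x) refl c (egfCoeff 1) ⟩
      1ℚ * c
        ≡⟨ cong (λ k → 1ℚ * egfCoeff (suc (suc k))) (ℕ.+-identityʳ m) ⟨
      1ℚ * egfCoeff (suc (suc (m ℕ.+ 0)))
        ∎
    where
    c : ℚ
    c = egfCoeff (suc (suc m))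
  ∫B-suc-suc (suc n) m = begin
      ∫B (suc m) (suc (suc n))
        ≡⟨ x+y≡z⇒x≡z-y (∫B-by-parts (suc m) (suc n)) ⟩
      bernoulliPoly (suc (suc m)) ev₁ * bernoulliPoly (suc (suc n)) ev₁ - c * c′ - ∫B (suc (suc m)) (suc n)
        ≡⟨ cong₂ (λ x y → x * y - c * c′ - ∫B (suc (suc m)) (suc n)) (bernoulliPoly-ev₁ m) (bernoulliPoly-ev₁ n) ⟩
      c * c′ - c * c′ - ∫B (suc (suc m)) (suc n)
        ≡⟨ cong (λ x → c * c′ - c * c′ - x) (∫B-suc-suc n (suc m)) ⟩
      c * c′ - c * c′ - neg1^ n * egfCoeff (suc (suc (suc m ℕ.+ n)))
        ≡⟨ solve 3 (λ x s y → x :- x :- s :* y := (:- s) :* y) refl (c * c′) (neg1^ n) (egfCoeff (suc (suc (suc m ℕ.+ n)))) ⟩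
      neg1^ (suc n) * egfCoeff (suc (suc (suc m ℕ.+ n)))
        ≡⟨ cong (λ k → neg1^ (suc n) * egfCoeff (suc (suc k))) (ℕ.+-suc m n) ⟨
      neg1^ (suc n) * egfCoeff (suc (suc (m ℕ.+ suc n)))
        ∎
    where
    c c′ : ℚ
    c = egfCoeff (suc (suc m))
    c′ = egfCoeff (suc (suc n))

  -- ∫B (2k+2) 1 and ∫B 1 (2k+2) evaluate to c_{2k+3} with opposite signs.
  egfCoeff-odd : ∀ k → egfCoeff (suc (2 ℕ.* suc k)) ≡ 0ℚ
  egfCoeff-odd k = trans (cong (λ i → egfCoeff (suc i)) (ℕ.*-suc 2 k)) (x≡-x⇒x≡0 c c≡-c)
    where
    n : ℕ
    n = suc (2 ℕ.* k)
    c : ℚ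
    c = egfCoeff (suc (suc n))
    c≡-c : c ≡ - c
    c≡-c = begin
      c                              ≡⟨ cong (λ i → egfCoeff (suc (suc i))) (ℕ.+-identityʳ n) ⟨
      egfCoeff (suc (suc (n ℕ.+ 0)))  ≡⟨ ℚ.*-identityˡ _ ⟨
      1ℚ * egfCoeff (suc (suc (n ℕ.+ 0))) ≡⟨ ∫B-suc-suc 0 n ⟨
      ∫B (suc n) 1                   ≡⟨ ∫B-comm (suc n) 1 ⟩
      ∫B 1 (suc n)                   ≡⟨ ∫B-suc-suc n 0 ⟩
      neg1^ (suc (2 ℕ.* k)) * c      ≡⟨ cong (λ s → - s * c) (neg1^-even k) ⟩
      - 1ℚ * c                       ≡⟨ solve 1 (λ x → (:- con 1ℚ) :* x := :- x) refl c ⟩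
      - c                            ∎

  2*[n/2]≡n⊎1+2*[n/2]≡n : ∀ n → 2 ℕ.* (n ℕ./ 2) ≡ n ⊎ suc (2 ℕ.* (n ℕ./ 2)) ≡ n
  2*[n/2]≡n⊎1+2*[n/2]≡n n with n ℕ.% 2 | m%n<n n 2 | m≡m%n+[m/n]*n n 2
  ... | zero        | _                | n≡ = inj₁ (trans (ℕ.*-comm 2 (n ℕ./ 2)) (sym n≡))
  ... | suc zero    | _                | n≡ = inj₂ (trans (cong suc (ℕ.*-comm 2 (n ℕ./ 2))) (sym n≡))
  ... | suc (suc _) | s≤s (s≤s ())     | _

  k≤n/2⇒2*k≤n : ∀ {k} n → k ≤ n ℕ./ 2 → 2 ℕ.* k ≤ n
  k≤n/2⇒2*k≤n n k≤n/2 = ℕ.≤-trans (ℕ.*-monoʳ-≤ 2 k≤n/2) (subst (_≤ n) (ℕ.*-comm (n ℕ./ 2) 2) (m/n*n≤m n 2))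

  2*n∸a∸b+1≡1+[n∸a]+[n∸b] : ∀ n a b → a ≤ n → b ≤ n → 2 ℕ.* n ∸ a ∸ b ℕ.+ 1 ≡ suc ((n ∸ a) ℕ.+ (n ∸ b))
  2*n∸a∸b+1≡1+[n∸a]+[n∸b] n a b a≤n b≤n = begin
      2 ℕ.* n ∸ a ∸ b ℕ.+ 1          ≡⟨ cong (λ m → n ℕ.+ m ∸ a ∸ b ℕ.+ 1) (ℕ.+-identityʳ n) ⟩
      n ℕ.+ n ∸ a ∸ b ℕ.+ 1          ≡⟨ cong (λ m → m ∸ b ℕ.+ 1) (ℕ.+-∸-comm n a≤n) ⟩
      (n ∸ a) ℕ.+ n ∸ b ℕ.+ 1        ≡⟨ cong (ℕ._+ 1) (ℕ.+-∸-assoc (n ∸ a) b≤n) ⟩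
      (n ∸ a) ℕ.+ (n ∸ b) ℕ.+ 1      ≡⟨ ℕ.+-comm _ 1 ⟩
      suc ((n ∸ a) ℕ.+ (n ∸ b))      ∎

  [n∸2k]+n≡2*[n∸k] : ∀ n k → 2 ℕ.* k ≤ n → (n ∸ 2 ℕ.* k) ℕ.+ n ≡ 2 ℕ.* (n ∸ k)
  [n∸2k]+n≡2*[n∸k] n k 2k≤n = subst (λ m → (m ∸ 2 ℕ.* k) ℕ.+ m ≡ 2 ℕ.* (m ∸ k)) (ℕ.m∸n+n≡m 2k≤n) (begin
      (d ℕ.+ 2 ℕ.* k ∸ 2 ℕ.* k) ℕ.+ (d ℕ.+ 2 ℕ.* k)  ≡⟨ cong (ℕ._+ (d ℕ.+ 2 ℕ.* k)) (ℕ.m+n∸n≡m d (2 ℕ.* k)) ⟩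
      d ℕ.+ (d ℕ.+ 2 ℕ.* k)                        ≡⟨ d+[d+2k]≡2*[d+k] d k ⟩
      2 ℕ.* (d ℕ.+ k)                              ≡⟨ cong (2 ℕ.*_) (ℕ.m+n∸n≡m (d ℕ.+ k) k) ⟨
      2 ℕ.* (d ℕ.+ k ℕ.+ k ∸ k)                    ≡⟨ cong (λ m → 2 ℕ.* (m ∸ k)) (d+k+k≡d+2k d k) ⟩
      2 ℕ.* (d ℕ.+ 2 ℕ.* k ∸ k)                    ∎)
    where
    d : ℕ
    d = n ∸ 2 ℕ.* k
    d+[d+2k]≡2*[d+k] : ∀ d k → d ℕ.+ (d ℕ.+ 2 ℕ.* k) ≡ 2 ℕ.* (d ℕ.+ k)
    d+[d+2k]≡2*[d+k] = solve-∀
    d+k+k≡d+2k : ∀ d k → d ℕ.+ k ℕ.+ k ≡ d ℕ.+ 2 ℕ.* k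
    d+k+k≡d+2k = solve-∀

  2*[1+n]≡2+[n+n] : ∀ n → 2 ℕ.* suc n ≡ suc (suc (n ℕ.+ n))
  2*[1+n]≡2+[n+n] n = trans (ℕ.*-suc 2 n) (cong (λ m → suc (suc (n ℕ.+ m))) (ℕ.+-identityʳ n))

  -- reducedBernoulliPoly n is ρₙ, i.e. βₙ without its odd-index term c₁ xⁿ⁻¹/(n−1)!.

  reducedCoeff : ℕ → ℕ → ℚ
  reducedCoeff n k = B (2 ℕ.* k) * inv ((2 ℕ.* k) ! ℕ.* (n ∸ 2 ℕ.* k) !)

  reducedBernoulliPoly : ℕ → Functional
  reducedBernoulliPoly n = linearCombination (suc (n ℕ./ 2)) (reducedCoeff n) (λ k → n ∸ 2 ℕ.* k)

  reducedBernoulliPoly-isLinear : ∀ n → IsLinear (reducedBernoulliPoly n)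
  reducedBernoulliPoly-isLinear n = linearCombination-isLinear (suc (n ℕ./ 2)) (reducedCoeff n) (λ k → n ∸ 2 ℕ.* k)

  reducedCoeff≡ : ∀ n k → reducedCoeff n k ≡ egfCoeff (2 ℕ.* k) * inv ((n ∸ 2 ℕ.* k) !)
  reducedCoeff≡ n k = begin
      ℕ→ℚ F * egfCoeff (2 ℕ.* k) * inv (F ℕ.* G)
        ≡⟨ cong (ℕ→ℚ F * egfCoeff (2 ℕ.* k) *_) (inv-* F G {{(2 ℕ.* k) ℕ.!≢0}} {{(n ∸ 2 ℕ.* k) ℕ.!≢0}}) ⟩
      ℕ→ℚ F * egfCoeff (2 ℕ.* k) * (inv F * inv G)
        ≡⟨ solve 4 (λ x c y z → x :* c :* (y :* z) := (x :* y) :* (c :* z)) refl (ℕ→ℚ F) (egfCoeff (2 ℕ.* k)) (inv F) (inv G) ⟩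
      (ℕ→ℚ F * inv F) * (egfCoeff (2 ℕ.* k) * inv G)
        ≡⟨ cong (_* (egfCoeff (2 ℕ.* k) * inv G)) (ℕ→ℚ-*-inv F {{(2 ℕ.* k) ℕ.!≢0}}) ⟩
      1ℚ * (egfCoeff (2 ℕ.* k) * inv G)
        ≡⟨ ℚ.*-identityˡ _ ⟩
      egfCoeff (2 ℕ.* k) * inv G
        ∎
    where
    F G : ℕ
    F = (2 ℕ.* k) !
    G = (n ∸ 2 ℕ.* k) !

  -- the coefficient of xⁿ in βₙ₊₁
  subleadingCoeff : ℕ → ℚ
  subleadingCoeff n = egfCoeff 1 * inv (n !)

  reducedBernoulliPoly-suc : ∀ n φ → reducedBernoulliPoly (suc n) φ ≡ bernoulliPoly (suc n) φ - subleadingCoeff n * φ n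
  reducedBernoulliPoly-suc n φ = x+y≡z⇒x≡z-y (sym (begin
      bernoulliPoly N φ
        ≡⟨ ∑-reverse N (λ j → bernoulliCoeff N j * φ j) ⟩
      ∑ (suc N) (λ i → bernoulliCoeff N (N ∸ i) * φ (N ∸ i))
        ≡⟨ ∑-cong-< (suc N) (λ i i≤N → cong (λ j → egfCoeff j * inv ((N ∸ i) !) * φ (N ∸ i)) (ℕ.m∸[m∸n]≡n (ℕ.s≤s⁻¹ i≤N))) ⟩
      ∑ (suc N) f
        ≡⟨ ∑-odd-vanishing (N ℕ./ 2) f (2*[n/2]≡n⊎1+2*[n/2]≡n N) (s≤s z≤n) f-odd≡0 ⟩
      ∑ (suc (N ℕ./ 2)) (λ k → f (2 ℕ.* k)) + subleadingCoeff n * φ n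
        ≡⟨ cong (_+ subleadingCoeff n * φ n) (∑-cong (suc (N ℕ./ 2)) (λ k → cong (_* φ (N ∸ 2 ℕ.* k)) (reducedCoeff≡ N k))) ⟨
      reducedBernoulliPoly N φ + subleadingCoeff n * φ n
        ∎))
    where
    N : ℕ
    N = suc n
    f : ℕ → ℚ
    f i = egfCoeff i * inv ((N ∸ i) !) * φ (N ∸ i)
    f-odd≡0 : ∀ k → f (suc (2 ℕ.* suc k)) ≡ 0ℚ
    f-odd≡0 k = begin
        egfCoeff (suc (2 ℕ.* suc k)) * inv ((N ∸ suc (2 ℕ.* suc k)) !) * φ (N ∸ suc (2 ℕ.* suc k))
          ≡⟨ cong (λ c → c * inv ((N ∸ suc (2 ℕ.* suc k)) !) * φ (N ∸ suc (2 ℕ.* suc k))) (egfCoeff-odd k) ⟩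
        0ℚ * inv ((N ∸ suc (2 ℕ.* suc k)) !) * φ (N ∸ suc (2 ℕ.* suc k))
          ≡⟨ solve 2 (λ x y → con 0ℚ :* x :* y := con 0ℚ) refl (inv ((N ∸ suc (2 ℕ.* suc k)) !)) (φ (N ∸ suc (2 ℕ.* suc k))) ⟩
        0ℚ
          ∎

  S₂≡∫[reduced·reduced] : ∀ n → S₂ n ≡ ∫[ reducedBernoulliPoly n · reducedBernoulliPoly n ]
  S₂≡∫[reduced·reduced] n = begin
      Σ< (suc h) (λ k → w k * Σ< (suc h) (summand k))
        ≡⟨ Σ<≡∑ (suc h) (λ k → w k * Σ< (suc h) (summand k)) ⟩
      ∑ (suc h) (λ k → w k * Σ< (suc h) (summand k))
        ≡⟨ ∑-cong-< (suc h) (λ k k≤h → cong (w k *_) (trans (Σ<≡∑ (suc h) (summand k)) (∑-cong-< (suc h) (λ j j≤h →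
             cong (λ m → w j * inv m) (2*n∸a∸b+1≡1+[n∸a]+[n∸b] n (2 ℕ.* k) (2 ℕ.* j) (2k≤n k≤h) (2k≤n j≤h)))))) ⟩
      ∑ (suc h) (λ k → w k * ∑ (suc h) (λ j → w j * moment (n ∸ 2 ℕ.* k) (n ∸ 2 ℕ.* j)))
        ∎
    where
    h : ℕ
    h = n ℕ./ 2
    w : ℕ → ℚ
    w = reducedCoeff n
    summand : ℕ → ℕ → ℚ
    summand k j = w j * inv (2 ℕ.* n ∸ 2 ℕ.* k ∸ 2 ℕ.* j ℕ.+ 1)
    2k≤n : ∀ {k} → k < suc h → 2 ℕ.* k ≤ n
    2k≤n k≤h = k≤n/2⇒2*k≤n n (ℕ.s≤s⁻¹ k≤h)

  inv2*S₁≡∫[reduced·xⁿ] : ∀ n → inv 2 * S₁ (suc n) ≡ ∫[ reducedBernoulliPoly (suc n) · monomial n ]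
  inv2*S₁≡∫[reduced·xⁿ] n = begin
      inv 2 * Σ< (suc h) summand               ≡⟨ cong (inv 2 *_) (Σ<≡∑ (suc h) summand) ⟩
      inv 2 * ∑ (suc h) summand                ≡⟨ ∑-distribˡ-* (suc h) (inv 2) summand ⟨
      ∑ (suc h) (λ k → inv 2 * summand k)      ≡⟨ ∑-cong-< (suc h) halved-summand ⟩
      ∑ (suc h) (λ k → reducedCoeff N k * moment (N ∸ 2 ℕ.* k) n) ∎
    where
    N h : ℕ
    N = suc n
    h = N ℕ./ 2
    summand : ℕ → ℚ
    summand k = B (2 ℕ.* k) * inv ((2 ℕ.* k) ! ℕ.* (N ∸ 2 ℕ.* k) ! ℕ.* (N ∸ k))
    halved-summand : ∀ k → k < suc h → inv 2 * summand k ≡ reducedCoeff N k * moment (N ∸ 2 ℕ.* k) n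
    halved-summand k k≤h = begin
        inv 2 * (B (2 ℕ.* k) * inv (F ℕ.* m))
          ≡⟨ cong (λ x → inv 2 * (B (2 ℕ.* k) * x)) (inv-* F m {{(2 ℕ.* k) ℕ.!* (N ∸ 2 ℕ.* k) !≢0}} {{m≢0}}) ⟩
        inv 2 * (B (2 ℕ.* k) * (inv F * inv m))
          ≡⟨ solve 4 (λ t b f u → t :* (b :* (f :* u)) := b :* f :* (t :* u)) refl (inv 2) (B (2 ℕ.* k)) (inv F) (inv m) ⟩
        reducedCoeff N k * (inv 2 * inv m)
          ≡⟨ cong (reducedCoeff N k *_) (inv-* 2 m {{_}} {{m≢0}}) ⟨
        reducedCoeff N k * inv (2 ℕ.* m)
          ≡⟨ cong (λ x → reducedCoeff N k * inv x) 1+[N∸2k]+n≡2m ⟨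
        reducedCoeff N k * moment (N ∸ 2 ℕ.* k) n
          ∎
      where
      F m : ℕ
      F = (2 ℕ.* k) ! ℕ.* (N ∸ 2 ℕ.* k) !
      m = N ∸ k
      1+[N∸2k]+n≡2m : suc ((N ∸ 2 ℕ.* k) ℕ.+ n) ≡ 2 ℕ.* m
      1+[N∸2k]+n≡2m = trans (sym (ℕ.+-suc (N ∸ 2 ℕ.* k) n)) ([n∸2k]+n≡2*[n∸k] N k (k≤n/2⇒2*k≤n N (ℕ.s≤s⁻¹ k≤h)))
      m≢0 : NonZero m
      m≢0 = ℕ.m*n≢0⇒n≢0 2 {{ℕ.≢-nonZero (λ 2m≡0 → ℕ.1+n≢0 (trans 1+[N∸2k]+n≡2m 2m≡0))}}

  module _ (n : ℕ) where

    private
      q : Functional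
      q = reducedBernoulliPoly (suc n)
      r T k₀ N! : ℚ
      r = subleadingCoeff n
      T = ∫[ bernoulliPoly (suc n) · monomial n ]
      k₀ = moment n n
      N! = ℕ→ℚ ((2 ℕ.* suc n) !)

    S₁-closed : S₁ (suc n) ≡ ℕ→ℚ 2 * (T - r * k₀)
    S₁-closed = begin
        S₁ (suc n)                          ≡⟨ solve 1 (λ x → x := con (ℕ→ℚ 2) :* (con (inv 2) :* x)) refl (S₁ (suc n)) ⟩
        ℕ→ℚ 2 * (inv 2 * S₁ (suc n))        ≡⟨ cong (ℕ→ℚ 2 *_) (inv2*S₁≡∫[reduced·xⁿ] n) ⟩
        ℕ→ℚ 2 * ∫[ q · monomial n ]         ≡⟨ cong (ℕ→ℚ 2 *_) (reducedBernoulliPoly-suc n (λ i → moment i n)) ⟩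
        ℕ→ℚ 2 * (T - r * k₀)                ∎

    S₂-closed : S₂ (suc n) ≡ ∫B (suc n) (suc n) - r * T - r * (T - r * k₀)
    S₂-closed = begin
        S₂ (suc n)
          ≡⟨ S₂≡∫[reduced·reduced] (suc n) ⟩
        q (λ i → q (moment i))
          ≡⟨ q.extensional (λ i → reducedBernoulliPoly-suc n (moment i)) ⟩
        q (λ i → P (moment i) - r * moment i n)
          ≡⟨ q.subtractive (λ i → P (moment i)) (λ i → r * moment i n) ⟩
        q (λ i → P (moment i)) - q (λ i → r * moment i n)
          ≡⟨ cong (λ x → q (λ i → P (moment i)) - x) (q.homogeneous r (λ i → moment i n)) ⟩
        q (λ i → P (moment i)) - r * q (λ i → moment i n)
          ≡⟨ cong₂ (λ x y → x - r * y) (reducedBernoulliPoly-suc n (λ i → P (moment i))) (reducedBernoulliPoly-suc n (λ i → moment i n)) ⟩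
        ∫B (suc n) (suc n) - r * P (moment n) - r * (T - r * k₀)
          ≡⟨ cong (λ x → ∫B (suc n) (suc n) - r * x - r * (T - r * k₀)) (IsLinear.extensional (bernoulliPoly-isLinear (suc n)) (moment-comm n)) ⟩
        ∫B (suc n) (suc n) - r * T - r * (T - r * k₀)
          ∎
      where
      P : Functional
      P = bernoulliPoly (suc n)
      module q = IsLinear (reducedBernoulliPoly-isLinear (suc n))

    ∫B-diagonal : ∫B (suc n) (suc n) ≡ neg1^ n * egfCoeff (2 ℕ.* suc n)
    ∫B-diagonal = trans (∫B-suc-suc n n) (cong (λ m → neg1^ n * egfCoeff m) (sym (2*[1+n]≡2+[n+n] n)))

    b-closed : b (suc n) ≡ - (N! * r)
    b-closed = begin
        N! * inv (2 ℕ.* n !)           ≡⟨ cong (N! *_) (inv-* 2 (n !) {{_}} {{n ℕ.!≢0}}) ⟩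
        N! * (inv 2 * inv (n !))       ≡⟨ solve 2 (λ x f → x :* (con (inv 2) :* f) := :- (x :* (con (- inv 2) :* f))) refl N! (inv (n !)) ⟩
        - (N! * r)                     ∎

    a-closed : a (suc n) ≡ N! * r * r * k₀
    a-closed = sym (begin
        N! * r * r * k₀
          ≡⟨ cong (λ x → x * r * r * k₀) N!≡ ⟩
        ℕ→ℚ 2 * ℕ→ℚ (suc n) * (ℕ→ℚ (suc M) * G) * r * r * k₀
          ≡⟨ solve 5 (λ x y g f k → con (ℕ→ℚ 2) :* x :* (y :* g) :* (con (- inv 2) :* f) :* (con (- inv 2) :* f) :* k
                                    := (x :* con (inv 2) :* (g :* (f :* f))) :* (y :* k)) refl (ℕ→ℚ (suc n)) (ℕ→ℚ (suc M)) G (inv (n !)) k₀ ⟩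
        ℕ→ℚ (suc n) * inv 2 * (G * (inv (n !) * inv (n !))) * (ℕ→ℚ (suc M) * k₀)
          ≡⟨ cong (ℕ→ℚ (suc n) * inv 2 * (G * (inv (n !) * inv (n !))) *_) (ℕ→ℚ-*-inv (suc M)) ⟩
        ℕ→ℚ (suc n) * inv 2 * (G * (inv (n !) * inv (n !))) * 1ℚ
          ≡⟨ ℚ.*-identityʳ _ ⟩
        ℕ→ℚ (suc n) * inv 2 * (G * (inv (n !) * inv (n !)))
          ≡⟨ cong₂ (λ x y → ℕ→ℚ (suc n) * inv 2 * (ℕ→ℚ (x !) * y)) (cong (_∸ 2) (2*[1+n]≡2+[n+n] n)) (inv-* (n !) (n !) {{n ℕ.!≢0}} {{n ℕ.!≢0}}) ⟨
        a (suc n)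
          ∎)
      where
      M : ℕ
      M = n ℕ.+ n
      G : ℚ
      G = ℕ→ℚ (M !)
      N!≡ : N! ≡ ℕ→ℚ 2 * ℕ→ℚ (suc n) * (ℕ→ℚ (suc M) * G)
      N!≡ = begin
          ℕ→ℚ ((2 ℕ.* suc n) !)                          ≡⟨ cong (λ x → ℕ→ℚ (x !)) (2*[1+n]≡2+[n+n] n) ⟩
          ℕ→ℚ (suc (suc M) ℕ.* (suc M ℕ.* M !))          ≡⟨ ℕ→ℚ-* (suc (suc M)) (suc M ℕ.* M !) ⟩
          ℕ→ℚ (suc (suc M)) * ℕ→ℚ (suc M ℕ.* M !)        ≡⟨ cong₂ _*_ (trans (cong ℕ→ℚ (sym (2*[1+n]≡2+[n+n] n))) (ℕ→ℚ-* 2 (suc n))) (ℕ→ℚ-* (suc M) (M !)) ⟩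
          ℕ→ℚ 2 * ℕ→ℚ (suc n) * (ℕ→ℚ (suc M) * G)       ∎

    bracket-closed : (a (suc n) - b (suc n) * S₁ (suc n)) + N! * S₂ (suc n) ≡ neg1^ n * B (2 ℕ.* suc n)
    bracket-closed = begin
        (a (suc n) - b (suc n) * S₁ (suc n)) + N! * S₂ (suc n)
          ≡⟨ cong₂ (λ x y → x + N! * y) (cong₂ (λ x y → x - y) a-closed (cong₂ _*_ b-closed S₁-closed)) S₂-closed ⟩
        (N! * r * r * k₀ - - (N! * r) * (ℕ→ℚ 2 * (T - r * k₀))) + N! * (I - r * T - r * (T - r * k₀))
          ≡⟨ solve 5 (λ N r k t i → (N :* r :* r :* k :- (:- (N :* r)) :* (con (ℕ→ℚ 2) :* (t :- r :* k))) :+ N :* (i :- r :* t :- r :* (t :- r :* k))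
                                  := N :* i) refl N! r k₀ T I ⟩
        N! * I
          ≡⟨ cong (N! *_) ∫B-diagonal ⟩
        N! * (neg1^ n * egfCoeff (2 ℕ.* suc n))
          ≡⟨ solve 3 (λ N s c → N :* (s :* c) := s :* (N :* c)) refl N! (neg1^ n) (egfCoeff (2 ℕ.* suc n)) ⟩
        neg1^ n * B (2 ℕ.* suc n)
          ∎
      where
      I : ℚ
      I = ∫B (suc n) (suc n)

open BernoulliIntegrals using (bracket-closed; neg1^-cancel)

open import Data.Nat using (ℕ; _≤_; _∸_; _!; _*_; zero; suc)
open import Data.Rational using () renaming (_+_ to _+ℚ_; _*_ to _*ℚ_; _-_ to _-ℚ_)
open import Relation.Binary.PropositionalEquality using (_≡_; sym; trans; cong)

theorem1 : (n : ℕ) → 1 ≤ n →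
    B (2 * n) ≡ neg1^ (n ∸ 1) *ℚ ((a n -ℚ (b n *ℚ S₁ n)) +ℚ (ℕ→ℚ ((2 * n) !) *ℚ S₂ n))
theorem1 zero    ()
theorem1 (suc n) _ = trans (sym (neg1^-cancel n (B (2 * suc n)))) (cong (neg1^ n *ℚ_) (sym (bracket-closed n)))
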